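{- For every integer $k \ge 3$ there exists a constant $c=c(k)>0$ such that for all sufficiently large $n$, $$f_k(n) \ge (1+c)\binom{n-1}{k-1}.$$
   Context: For integers $k\ge 2$ and $\ell \ge k+1$, the tight $k$-uniform $\ell$-cycle $TC_\ell^k$ is the $k$-uniform hypergraph on $\ell$ distinct vertices $v_0,\dots,v_{\ell-1}$ whose edges are all the $k$-sets $\{v_i,v_{i+1},\dots,v_{i+k-1}\}$, $i=0,\dots,\ell-1$, with subscripts taken modulo $\ell$. A $k$-uniform hypergraph is tight-cycle-free if it contains no subhypergraph isomorphic to $TC_\ell^k$ for any $\ell\ge k+1$. $f_k(n)$ denotes the maximum number of edges in a tight-cycle-free $k$-uniform hypergraph on $n$ vertices. -}

module Defs where

open import Data.Nat using (ℕ; suc; _+_; _*_; _≤_)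
open import Data.Nat.DivMod using (_mod_)
open import Data.Fin using (Fin; toℕ)
open import Data.Fin.Subset using (Subset; ∣_∣) renaming (_∈_ to _∈ₛ_)
open import Data.List using (List; length)
open import Data.List.Membership.Propositional using (_∈_)
open import Data.List.Relation.Unary.All using (All)
open import Data.List.Relation.Unary.Unique.Propositional using (Unique)
open import Data.Product using (Σ; ∃; _×_)
open import Relation.Binary.PropositionalEquality using (_≡_)
open import Function.Definitions using (Injective)
open import Relation.Nullary using (¬_)

record Hypergraph (k n : ℕ) : Set where
  field
    edges   : List (Subset n)
    unique  : Unique edges
    uniform : All (λ e → ∣ e ∣ ≡ k) edges

open Hypergraph public

numEdges : ∀ {k n} → Hypergraph k n → ℕ
numEdges H = length (edges H)

-- H contains a copy of the tight cycle TC^k_ℓ with ℓ = suc m ≥ k + 1: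
-- distinct vertices v_0,…,v_m (an injective map Fin (suc m) → Fin n) such that
-- for each i, the k-set {v_{i}, v_{i+1}, …, v_{i+k-1}} (indices mod ℓ) is an edge.
ContainsTightCycle : ∀ {k n} → Hypergraph k n → Set
ContainsTightCycle {k} {n} H =
  Σ ℕ λ m → (k ≤ m) ×
  Σ (Fin (suc m) → Fin n) λ v → Injective _≡_ _≡_ v ×
  ((i : Fin (suc m)) → Σ (Subset n) λ e → e ∈ edges H ×
     ((x : Fin n) → (x ∈ₛ e → ∃ λ (j : Fin k) → v ((toℕ i + toℕ j) mod suc m) ≡ x)
                  × ((∃ λ (j : Fin k) → v ((toℕ i + toℕ j) mod suc m) ≡ x) → x ∈ₛ e)))

TightCycleFree : ∀ {k n} → Hypergraph k n → Set
TightCycleFree H = ¬ ContainsTightCycle H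

module Submission where

-- Start from the friendship graph F_t (t triangles
-- sharing a centre) plus isolated vertices, and repeatedly *extend*: add an
-- apex and a block of m new vertices, and take as edges  apex ∪ S  for all
-- sets S meeting the block at least twice, and  a ∪ Q  for a block vertex a
-- and an old edge Q.
--
-- The k consecutive vertices of a
-- tight cycle form "windows".  In an extension no window contains the apex,
-- so every window is  a ∪ Q  with a single block vertex; the old vertices
-- thus realise the windows one level down, and at the top level the single
-- block vertex per window forces the cycle length to be at least 2k.  At
-- the bottom, the friendship property (adjacency paths must pass through
-- the centre) makes windows of a cycle of length ≥ 2k impossible.
--
-- If towers of uniformity j
-- have (1 + 1/c)·C(b-1, j-1) edges, extending by a block of size ≈ (4c+1)·b
-- gives (1 + 1/Q)·C(n-1, j) edges with Q = 4c·λ^(j-1); F_t gives the base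
-- case j = 2.  The theorem combines the two halves.

open import Defs
open import Data.Nat using (ℕ; _+_; _*_; _∸_; _≤_; _<_)
open import Data.Nat.Combinatorics using (_C_)
open import Data.Product using (Σ; _×_)

open import Data.Nat using (zero; suc; z≤n; s≤s; s≤s⁻¹; _^_; NonZero; >-nonZero; _≤?_; _<?_)
open import Data.Nat.Properties
open import Data.Nat.Combinatorics using (nCk+nC[k+1]≡[n+1]C[k+1])
open import Data.Nat.Tactic.RingSolver using (solve-∀)
open import Data.Nat.DivMod using (_mod_; _%_; %-distribˡ-+; m%n%n≡m%n; m<n⇒m%n≡m; m≤n⇒[n∸m]%m≡n%m; [m+n]%n≡m%n; m%n<n; _/_; m≡m%n+[m/n]*n; m/n*n≤m)
open import Data.Fin using (Fin; zero; suc; toℕ; fromℕ<; _↑ˡ_; _↑ʳ_)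
import Data.Fin.Properties as Fin
open import Data.Fin.Subset using (Subset; inside; outside; ⁅_⁆; ⊥; ∣_∣) renaming (_∈_ to _∈ₛ_)
open import Data.Fin.Subset.Properties using (x∈⁅x⁆; x∈⁅y⁆⇒x≡y; ∣⁅x⁆∣≡1; ∣⊥∣≡0; ∉⊥)
open import Data.Vec using (_∷_; []; _++_; here; there)
import Data.Vec.Properties as Vec
open import Data.List using (List; []; _∷_; [_]; map; length; allFin; cartesianProductWith) renaming (_++_ to _++ₗ_)
open import Data.List.Properties using (length-map; length-++; length-tabulate)
open import Data.List.Membership.Propositional using (_∈_)
open import Data.List.Membership.Propositional.Properties using (∈-map⁻; ∈-++⁻; ∈-cartesianProductWith⁻)
open import Data.List.Relation.Unary.All using (All; []; _∷_) renaming (map to all-map; lookup to all-lookup)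
import Data.List.Relation.Unary.All.Properties as All
open import Data.List.Relation.Unary.Unique.Propositional using (Unique)
import Data.List.Relation.Unary.Unique.Propositional.Properties as Unique
open import Data.List.Relation.Unary.AllPairs using () renaming ([] to []ᵘ; _∷_ to _∷ᵘ_)
open import Data.Product using (_,_; proj₁; proj₂; ∃)
open import Data.Sum using (_⊎_; inj₁; inj₂) renaming (swap to ⊎-swap)
open import Data.Empty using (⊥-elim) renaming (⊥ to Void)
open import Relation.Nullary using (¬_; yes; no)
open import Relation.Binary.PropositionalEquality hiding ([_])
open import Function using (id; _∘_)
open import Function.Definitions using (Injective)

-- Binomial coefficients by Pascal's rule (the recursion drives every
-- counting induction below); they agree with the library's n C k.
binom : ℕ → ℕ → ℕ
binom n       zero    = 1
binom zero    (suc r) = 0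
binom (suc n) (suc r) = binom n r + binom n (suc r)

binom≡C : ∀ n r → binom n r ≡ n C r
binom≡C n       zero    = refl
binom≡C zero    (suc r) = refl
binom≡C (suc n) (suc r) =
  trans (cong₂ _+_ (binom≡C n r) (binom≡C n (suc r))) (nCk+nC[k+1]≡[n+1]C[k+1] n r)

binom-1 : ∀ n → binom n 1 ≡ n
binom-1 zero    = refl
binom-1 (suc n) = cong suc (binom-1 n)

binom-absorb : ∀ n r → suc r * binom (suc n) (suc r) ≡ suc n * binom n r
binom-absorb zero    zero    = refl
binom-absorb zero    (suc r) = *-zeroʳ (suc (suc r))
binom-absorb (suc n) zero    = trans (+-identityʳ _) (trans (binom-1 (suc (suc n))) (sym (*-identityʳ _)))
binom-absorb (suc n) (suc r) = begin
    suc (suc r) * (binom (suc n) (suc r) + binom (suc n) (suc (suc r)))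
  ≡⟨ *-distribˡ-+ (suc (suc r)) (binom (suc n) (suc r)) _ ⟩
    binom (suc n) (suc r) + suc r * binom (suc n) (suc r) + suc (suc r) * binom (suc n) (suc (suc r))
  ≡⟨ cong₂ (λ u w → binom (suc n) (suc r) + u + w) (binom-absorb n r) (binom-absorb n (suc r)) ⟩
    binom (suc n) (suc r) + suc n * binom n r + suc n * binom n (suc r)
  ≡⟨ +-assoc (binom (suc n) (suc r)) _ _ ⟩
    binom (suc n) (suc r) + (suc n * binom n r + suc n * binom n (suc r))
  ≡⟨ cong (binom (suc n) (suc r) +_) (sym (*-distribˡ-+ (suc n) (binom n r) _)) ⟩
    suc (suc n) * binom (suc n) (suc r) ∎
  where open ≡-Reasoning

binom-scale : ∀ lam r x y → y ≤ lam * (x ∸ r) → binom y r ≤ lam ^ r * binom x r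
binom-scale lam zero    x       zero    le = s≤s z≤n
binom-scale lam zero    x       (suc y) le = s≤s z≤n
binom-scale lam (suc r) x       zero    le = z≤n
binom-scale lam (suc r) zero    (suc y) le with () ← subst (suc y ≤_) (*-zeroʳ lam) le
binom-scale lam (suc r) (suc x) (suc y) le = *-cancelˡ-≤ (suc r) (begin
    suc r * binom (suc y) (suc r)              ≡⟨ binom-absorb y r ⟩
    suc y * binom y r                          ≤⟨ *-mono-≤ y≤ ih ⟩
    (lam * suc x) * (lam ^ r * binom x r)      ≡⟨ regroup lam (suc x) (lam ^ r) (binom x r) ⟩
    lam ^ suc r * (suc x * binom x r)          ≡⟨ cong (lam ^ suc r *_) (sym (binom-absorb x r)) ⟩
    lam ^ suc r * (suc r * binom (suc x) (suc r)) ≡⟨ x∙yz≡y∙xz (lam ^ suc r) (suc r) _ ⟩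
    suc r * (lam ^ suc r * binom (suc x) (suc r)) ∎)
  where
  open ≤-Reasoning
  ih : binom y r ≤ lam ^ r * binom x r
  ih = binom-scale lam r x y (≤-trans (n≤1+n y) le)
  y≤ : suc y ≤ lam * suc x
  y≤ = ≤-trans le (*-monoʳ-≤ lam (≤-trans (m∸n≤m x r) (n≤1+n x)))
  regroup : ∀ a b c d → (a * b) * (c * d) ≡ (a * c) * (b * d)
  regroup = solve-∀
  x∙yz≡y∙xz : ∀ a b c → a * (b * c) ≡ b * (a * c)
  x∙yz≡y∙xz = solve-∀

fork : ∀ {n} → List (Subset n) → List (Subset n) → List (Subset (suc n))
fork xs ys = map (inside ∷_) xs ++ₗ map (outside ∷_) ys

fork-length : ∀ {n} (xs ys : List (Subset n)) → length (fork xs ys) ≡ length xs + length ys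
fork-length xs ys = trans (length-++ (map (inside ∷_) xs)) (cong₂ _+_ (length-map _ xs) (length-map _ ys))

fork-unique : ∀ {n} {xs ys : List (Subset n)} → Unique xs → Unique ys → Unique (fork xs ys)
fork-unique ux uy = Unique.++⁺ (Unique.map⁺ Vec.∷-injectiveʳ ux) (Unique.map⁺ Vec.∷-injectiveʳ uy) disjoint
  where
  disjoint : ∀ {S} → S ∈ map (inside ∷_) _ × S ∈ map (outside ∷_) _ → Void
  disjoint (p , q) with ∈-map⁻ (inside ∷_) p | ∈-map⁻ (outside ∷_) q
  ... | _ , _ , refl | _ , _ , ()

fork-card : ∀ {n r} {xs ys : List (Subset n)} →
  All (λ S → ∣ S ∣ ≡ r) xs → All (λ S → ∣ S ∣ ≡ suc r) ys → All (λ S → ∣ S ∣ ≡ suc r) (fork xs ys)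
fork-card ax ay = All.++⁺ (All.map⁺ (all-map (cong suc) ax)) (All.map⁺ ay)

fork-view : ∀ {n} (xs {ys} : List (Subset n)) {S} → S ∈ fork xs ys →
  (Σ (Subset n) λ S' → S' ∈ xs × S ≡ inside ∷ S') ⊎ (Σ (Subset n) λ S' → S' ∈ ys × S ≡ outside ∷ S')
fork-view xs h with ∈-++⁻ (map (inside ∷_) xs) h
... | inj₁ h′ = inj₁ (∈-map⁻ (inside ∷_) h′)
... | inj₂ h′ = inj₂ (∈-map⁻ (outside ∷_) h′)

subsets : (n r : ℕ) → List (Subset n)
subsets n       zero    = [ ⊥ ]
subsets zero    (suc r) = []
subsets (suc n) (suc r) = fork (subsets n r) (subsets n (suc r))

subsets-length : ∀ n r → length (subsets n r) ≡ binom n r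
subsets-length n       zero    = refl
subsets-length zero    (suc r) = refl
subsets-length (suc n) (suc r) =
  trans (fork-length (subsets n r) _) (cong₂ _+_ (subsets-length n r) (subsets-length n (suc r)))

subsets-unique : ∀ n r → Unique (subsets n r)
subsets-unique n       zero    = [] ∷ᵘ []ᵘ
subsets-unique zero    (suc r) = []ᵘ
subsets-unique (suc n) (suc r) = fork-unique (subsets-unique n r) (subsets-unique n (suc r))

subsets-card : ∀ n r → All (λ S → ∣ S ∣ ≡ r) (subsets n r)
subsets-card n       zero    = ∣⊥∣≡0 n ∷ []
subsets-card zero    (suc r) = []
subsets-card (suc n) (suc r) = fork-card (subsets-card n r) (subsets-card n (suc r))

meetOnce : (m b r : ℕ) → List (Subset (m + b))
meetOnce zero    b r       = []
meetOnce (suc m) b zero    = []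
meetOnce (suc m) b (suc r) = fork (subsets (m + b) r) (meetOnce m b (suc r))

meetTwice : (m b r : ℕ) → List (Subset (m + b))
meetTwice zero    b r       = []
meetTwice (suc m) b zero    = []
meetTwice (suc m) b (suc r) = fork (meetOnce m b r) (meetTwice m b (suc r))

meetOnce-unique : ∀ m b r → Unique (meetOnce m b r)
meetOnce-unique zero    b r       = []ᵘ
meetOnce-unique (suc m) b zero    = []ᵘ
meetOnce-unique (suc m) b (suc r) = fork-unique (subsets-unique (m + b) r) (meetOnce-unique m b (suc r))

meetTwice-unique : ∀ m b r → Unique (meetTwice m b r)
meetTwice-unique zero    b r       = []ᵘ
meetTwice-unique (suc m) b zero    = []ᵘ
meetTwice-unique (suc m) b (suc r) = fork-unique (meetOnce-unique m b r) (meetTwice-unique m b (suc r))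

meetOnce-card : ∀ m b r → All (λ S → ∣ S ∣ ≡ r) (meetOnce m b r)
meetOnce-card zero    b r       = []
meetOnce-card (suc m) b zero    = []
meetOnce-card (suc m) b (suc r) = fork-card (subsets-card (m + b) r) (meetOnce-card m b (suc r))

meetTwice-card : ∀ m b r → All (λ S → ∣ S ∣ ≡ r) (meetTwice m b r)
meetTwice-card zero    b r       = []
meetTwice-card (suc m) b zero    = []
meetTwice-card (suc m) b (suc r) = fork-card (meetOnce-card m b r) (meetTwice-card m b (suc r))

-- Classifying r-subsets by how often they meet Fin m:
-- C(m+b, r) = #(meet at least once) + C(b, r).
meetOnce-length : ∀ m b r → length (meetOnce m b r) + binom b r ≡ binom (m + b) r
meetOnce-length zero    b r       = refl
meetOnce-length (suc m) b zero    = refl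
meetOnce-length (suc m) b (suc r) = begin
    length (fork (subsets (m + b) r) (meetOnce m b (suc r))) + binom b (suc r)
  ≡⟨ cong (_+ binom b (suc r)) (fork-length (subsets (m + b) r) _) ⟩
    length (subsets (m + b) r) + length (meetOnce m b (suc r)) + binom b (suc r)
  ≡⟨ +-assoc (length (subsets (m + b) r)) _ _ ⟩
    length (subsets (m + b) r) + (length (meetOnce m b (suc r)) + binom b (suc r))
  ≡⟨ cong₂ _+_ (subsets-length (m + b) r) (meetOnce-length m b (suc r)) ⟩
    binom (m + b) r + binom (m + b) (suc r) ∎
  where open ≡-Reasoning

-- C(m+b, r+1) = #(meet at least twice) + #(meet never) + #(meet exactly once).
meetTwice-length : ∀ m b r →
  length (meetTwice m b (suc r)) + binom b (suc r) + m * binom b r ≡ binom (m + b) (suc r)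
meetTwice-length zero    b r = +-identityʳ _
meetTwice-length (suc m) b r = begin
    length (fork (meetOnce m b r) (meetTwice m b (suc r))) + binom b (suc r) + (binom b r + m * binom b r)
  ≡⟨ cong (λ z → z + binom b (suc r) + (binom b r + m * binom b r)) (fork-length (meetOnce m b r) _) ⟩
    once + twice + binom b (suc r) + (binom b r + m * binom b r)
  ≡⟨ regroup once twice (binom b (suc r)) (binom b r) (m * binom b r) ⟩
    (once + binom b r) + (twice + binom b (suc r) + m * binom b r)
  ≡⟨ cong₂ _+_ (meetOnce-length m b r) (meetTwice-length m b r) ⟩
    binom (m + b) r + binom (m + b) (suc r) ∎
  where
  open ≡-Reasoning
  once  = length (meetOnce m b r)
  twice = length (meetTwice m b (suc r))
  regroup : ∀ a c d e f → a + c + d + (e + f) ≡ (a + e) + (c + d + f)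
  regroup = solve-∀

meetOnce-mem : ∀ m b r {S} → S ∈ meetOnce m b r → Σ (Fin m) λ a → (a ↑ˡ b) ∈ₛ S
meetOnce-mem (suc m) b (suc r) h with fork-view (subsets (m + b) r) h
... | inj₁ (_ , _ , refl) = zero , here
... | inj₂ (_ , h′ , refl) with meetOnce-mem m b (suc r) h′
...   | a , a∈ = suc a , there a∈

meetTwice-mem : ∀ m b r {S} → S ∈ meetTwice m b r →
  Σ (Fin m) λ a₁ → Σ (Fin m) λ a₂ → a₁ ≢ a₂ × (a₁ ↑ˡ b) ∈ₛ S × (a₂ ↑ˡ b) ∈ₛ S
meetTwice-mem (suc m) b (suc r) h with fork-view (meetOnce m b r) h
... | inj₁ (_ , h′ , refl) with meetOnce-mem m b r h′
...   | a , a∈ = zero , suc a , (λ ()) , here , there a∈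
meetTwice-mem (suc m) b (suc r) h | inj₂ (_ , h′ , refl) with meetTwice-mem m b (suc r) h′
...   | a₁ , a₂ , a₁≢a₂ , a₁∈ , a₂∈ = suc a₁ , suc a₂ , (λ e → a₁≢a₂ (Fin.suc-injective e)) , there a₁∈ , there a₂∈

card-++ : ∀ {a b} (p : Subset a) (q : Subset b) → ∣ p ++ q ∣ ≡ ∣ p ∣ + ∣ q ∣
card-++ []            q = refl
card-++ (inside ∷ p)  q = cong suc (card-++ p q)
card-++ (outside ∷ p) q = card-++ p q

∈-++⁺ˡ : ∀ {a b} {x : Fin a} (p : Subset a) (q : Subset b) → x ∈ₛ p → (x ↑ˡ b) ∈ₛ (p ++ q)
∈-++⁺ˡ {x = x} p q h = Vec.lookup⇒[]= _ _ (trans (Vec.lookup-++ˡ p q x) (Vec.[]=⇒lookup h))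

∈-++⁻ˡ : ∀ {a b} {x : Fin a} (p : Subset a) (q : Subset b) → (x ↑ˡ b) ∈ₛ (p ++ q) → x ∈ₛ p
∈-++⁻ˡ {x = x} p q h = Vec.lookup⇒[]= _ _ (trans (sym (Vec.lookup-++ˡ p q x)) (Vec.[]=⇒lookup h))

∈-++⁺ʳ : ∀ {a b} {y : Fin b} (p : Subset a) (q : Subset b) → y ∈ₛ q → (a ↑ʳ y) ∈ₛ (p ++ q)
∈-++⁺ʳ {y = y} p q h = Vec.lookup⇒[]= _ _ (trans (Vec.lookup-++ʳ p q y) (Vec.[]=⇒lookup h))

∈-++⁻ʳ : ∀ {a b} {y : Fin b} (p : Subset a) (q : Subset b) → (a ↑ʳ y) ∈ₛ (p ++ q) → y ∈ₛ q
∈-++⁻ʳ {y = y} p q h = Vec.lookup⇒[]= _ _ (trans (sym (Vec.lookup-++ʳ p q y)) (Vec.[]=⇒lookup h))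

split-view : ∀ a b (x : Fin (a + b)) → (Σ (Fin a) λ i → x ≡ i ↑ˡ b) ⊎ (Σ (Fin b) λ j → x ≡ a ↑ʳ j)
split-view zero    b x       = inj₂ (x , refl)
split-view (suc a) b zero    = inj₁ (zero , refl)
split-view (suc a) b (suc x) with split-view a b x
... | inj₁ (i , eq) = inj₁ (suc i , cong suc eq)
... | inj₂ (j , eq) = inj₂ (j , cong suc eq)

↑ˡ≢↑ʳ : ∀ {a b} (i : Fin a) (j : Fin b) → i ↑ˡ b ≢ a ↑ʳ j
↑ˡ≢↑ʳ {a} i j eq = <⇒≢ (≤-trans (subst (_< a) (sym (Fin.toℕ-↑ˡ i _)) (Fin.toℕ<n i)) (m≤m+n a (toℕ j)))
                       (trans (cong toℕ eq) (Fin.toℕ-↑ʳ a j))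

⁅⁆-injective : ∀ {n} {x y : Fin n} → ⁅ x ⁆ ≡ ⁅ y ⁆ → x ≡ y
⁅⁆-injective {x = x} {y} eq = x∈⁅y⁆⇒x≡y y (subst (x ∈ₛ_) eq (x∈⁅x⁆ x))

length-cartesianProductWith : ∀ {A B C : Set} (f : A → B → C) (xs : List A) (ys : List B) →
  length (cartesianProductWith f xs ys) ≡ length xs * length ys
length-cartesianProductWith f []       ys = refl
length-cartesianProductWith f (x ∷ xs) ys =
  trans (length-++ (map (f x) ys)) (cong₂ _+_ (length-map (f x) ys) (length-cartesianProductWith f xs ys))

length-allFin : ∀ n → length (allFin n) ≡ n
length-allFin n = length-tabulate {n = n} id

-- A tower of uniformity j is built from a friendship
-- graph by repeated extensions:
--  * friendship t e : on the vertices  centre 0, leaves Fin (t + t), and e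
--    isolated vertices, the edges are the 2t spokes {0, ℓ} and the t rungs
--    {X i, Y i}  (X i, Y i the i-th leaf of the first, second half);
--  * extend m s : on the vertices  apex 0, a new block Fin m, and the
--    vertices of s, the edges are  {apex} ∪ S  for the j-sets S meeting the
--    block at least twice, and  {a} ∪ Q  for a in the block and Q an edge of s.
data Tower : ℕ → Set where
  friendship : (t e : ℕ) → Tower 2
  extend     : ∀ {j} → ℕ → Tower j → Tower (suc j)

order : ∀ {j} → Tower j → ℕ
order (friendship t e) = suc ((t + t) + e)
order (extend m s)     = suc (m + order s)

spokes : (t e : ℕ) → List (Subset ((t + t) + e))
spokes t e = map (λ ℓ → ⁅ ℓ ⁆ ++ ⊥) (allFin (t + t))

rungs : (t e : ℕ) → List (Subset ((t + t) + e))
rungs t e = map (λ i → (⁅ i ⁆ ++ ⁅ i ⁆) ++ ⊥) (allFin t)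

attach : ∀ {m b} → Fin m → Subset b → Subset (m + b)
attach a Q = ⁅ a ⁆ ++ Q

edgeList : ∀ {j} (s : Tower j) → List (Subset (order s))
edgeList (friendship t e)  = fork (spokes t e) (rungs t e)
edgeList (extend {j} m s) = fork (meetTwice m (order s) j) (cartesianProductWith attach (allFin m) (edgeList s))

edgeList-unique : ∀ {j} (s : Tower j) → Unique (edgeList s)
edgeList-unique (friendship t e) = fork-unique (Unique.map⁺ spoke-inj (Unique.allFin⁺ _)) (Unique.map⁺ rung-inj (Unique.allFin⁺ _))
  where
  spoke-inj : ∀ {x y : Fin (t + t)} → ⁅ x ⁆ ++ ⊥ {e} ≡ ⁅ y ⁆ ++ ⊥ → x ≡ y
  spoke-inj eq = ⁅⁆-injective (Vec.++-injectiveˡ _ _ eq)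
  rung-inj : ∀ {x y : Fin t} → (⁅ x ⁆ ++ ⁅ x ⁆) ++ ⊥ {e} ≡ (⁅ y ⁆ ++ ⁅ y ⁆) ++ ⊥ → x ≡ y
  rung-inj eq = ⁅⁆-injective (Vec.++-injectiveˡ _ _ (Vec.++-injectiveˡ _ _ eq))
edgeList-unique (extend {j} m s) = fork-unique (meetTwice-unique m (order s) j)
  (Unique.cartesianProductWith⁺ attach attach-inj (Unique.allFin⁺ m) (edgeList-unique s))
  where
  attach-inj : ∀ {a a′ Q Q′} → attach {m} {order s} a Q ≡ attach a′ Q′ → a ≡ a′ × Q ≡ Q′
  attach-inj eq = ⁅⁆-injective (Vec.++-injectiveˡ _ _ eq) , Vec.++-injectiveʳ _ _ eq

edgeList-card : ∀ {j} (s : Tower j) → All (λ S → ∣ S ∣ ≡ j) (edgeList s)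
edgeList-card (friendship t e) = fork-card (All.map⁺ (All.tabulate⁺ spoke-card)) (All.map⁺ (All.tabulate⁺ rung-card))
  where
  spoke-card : (ℓ : Fin (t + t)) → ∣ ⁅ ℓ ⁆ ++ ⊥ {n = e} ∣ ≡ 1
  spoke-card ℓ = trans (card-++ ⁅ ℓ ⁆ ⊥) (cong₂ _+_ (∣⁅x⁆∣≡1 ℓ) (∣⊥∣≡0 e))
  rung-card : (i : Fin t) → ∣ (⁅ i ⁆ ++ ⁅ i ⁆) ++ ⊥ {n = e} ∣ ≡ 2
  rung-card i = trans (card-++ (⁅ i ⁆ ++ ⁅ i ⁆) ⊥)
    (cong₂ _+_ (trans (card-++ ⁅ i ⁆ ⁅ i ⁆) (cong₂ _+_ (∣⁅x⁆∣≡1 i) (∣⁅x⁆∣≡1 i))) (∣⊥∣≡0 e))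
edgeList-card (extend {j} m s) = fork-card (meetTwice-card m (order s) j)
  (All.cartesianProductWith⁺ (setoid _) (setoid _) attach (allFin m) (edgeList s) attach-card)
  where
  attach-card : ∀ {a Q} → a ∈ allFin m → Q ∈ edgeList s → ∣ attach a Q ∣ ≡ suc j
  attach-card {a} {Q} _ Q∈ = trans (card-++ ⁅ a ⁆ Q) (cong₂ _+_ (∣⁅x⁆∣≡1 a) (all-lookup (edgeList-card s) Q∈))

towerGraph : ∀ {j} (s : Tower j) → Hypergraph j (order s)
towerGraph s = record { edges = edgeList s ; unique = edgeList-unique s ; uniform = edgeList-card s }

size : ∀ {j} → Tower j → ℕ
size s = length (edgeList s)

size-friendship : ∀ t e → size (friendship t e) ≡ (t + t) + t
size-friendship t e = trans (fork-length (spokes t e) _)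
  (cong₂ _+_ (trans (length-map _ (allFin (t + t))) (length-allFin (t + t)))
             (trans (length-map _ (allFin t)) (length-allFin t)))

size-extend : ∀ {j} m (s : Tower j) → size (extend m s) ≡ length (meetTwice m (order s) j) + m * size s
size-extend {j} m s = trans (fork-length (meetTwice m (order s) j) _) (cong (length (meetTwice m (order s) j) +_)
  (trans (length-cartesianProductWith attach (allFin m) (edgeList s)) (cong (_* size s) (length-allFin m))))

record IsPair {n} (Q : Subset n) (u w : Fin n) : Set where
  field
    u∈   : u ∈ₛ Q
    w∈   : w ∈ₛ Q
    u≢w  : u ≢ w
    only : ∀ y → y ∈ₛ Q → y ≡ u ⊎ y ≡ w

partner : ∀ {n} {Q : Subset n} {u w β} → IsPair Q u w → β ∈ₛ Q →
  Σ (Fin n) λ o → o ∈ₛ Q × o ≢ β × (∀ y → y ∈ₛ Q → y ≡ β ⊎ y ≡ o)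
partner {u = u} {w = w} {β = β} P β∈ with IsPair.only P β β∈
... | inj₁ refl = w , IsPair.w∈ P , (λ eq → IsPair.u≢w P (sym eq)) , IsPair.only P
... | inj₂ refl = u , IsPair.u∈ P , IsPair.u≢w P , λ y y∈ → ⊎-swap (IsPair.only P y y∈)

pair-exhausted : ∀ {n} {Q : Subset n} {u w β β′} → IsPair Q u w → β ∈ₛ Q → β′ ∈ₛ Q → β ≢ β′ →
  ∀ y → y ∈ₛ Q → y ≡ β ⊎ y ≡ β′
pair-exhausted {β = β} {β′ = β′} P β∈ β′∈ β≢β′ y y∈
  with IsPair.only P β β∈ | IsPair.only P β′ β′∈ | IsPair.only P y y∈
... | inj₁ p | inj₁ p′ | _       = ⊥-elim (β≢β′ (trans p (sym p′)))
... | inj₂ p | inj₂ p′ | _       = ⊥-elim (β≢β′ (trans p (sym p′)))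
... | inj₁ p | inj₂ p′ | inj₁ py = inj₁ (trans py (sym p))
... | inj₁ p | inj₂ p′ | inj₂ py = inj₂ (trans py (sym p′))
... | inj₂ p | inj₁ p′ | inj₁ py = inj₂ (trans py (sym p′))
... | inj₂ p | inj₁ p′ | inj₂ py = inj₁ (trans py (sym p))

-- The rungs form a matching, which yields the two path facts used
-- in the cycle argument.
module Friendship (t e : ℕ) where

  Vertex : Set
  Vertex = Fin (order (friendship t e))

  centre : Vertex
  centre = zero

  leaf : Fin (t + t) → Vertex
  leaf ℓ = suc (ℓ ↑ˡ e)

  X Y : Fin t → Vertex
  X i = leaf (i ↑ˡ t)
  Y i = leaf (t ↑ʳ i)

  Rung : Vertex → Vertex → Set
  Rung β β′ = Σ (Fin t) λ i → (β ≡ X i × β′ ≡ Y i) ⊎ (β ≡ Y i × β′ ≡ X i)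

  Adjacent : Vertex → Vertex → Set
  Adjacent β β′ = β ≡ centre ⊎ β′ ≡ centre ⊎ Rung β β′

  rung-sym : ∀ {β β′} → Rung β β′ → Rung β′ β
  rung-sym (i , inj₁ (p , q)) = i , inj₂ (q , p)
  rung-sym (i , inj₂ (p , q)) = i , inj₁ (q , p)

  leaf-injective : ∀ {ℓ ℓ′} → leaf ℓ ≡ leaf ℓ′ → ℓ ≡ ℓ′
  leaf-injective eq = Fin.↑ˡ-injective e _ _ (Fin.suc-injective eq)

  X≢Y : ∀ i i′ → X i ≢ Y i′
  X≢Y i i′ eq = ↑ˡ≢↑ʳ i i′ (leaf-injective eq)

  rung-functional : ∀ {β β′ β″} → Rung β β′ → Rung β β″ → β′ ≡ β″
  rung-functional (i , inj₁ (p , q)) (i′ , inj₁ (p′ , q′)) =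
    trans q (trans (cong Y (Fin.↑ˡ-injective t _ _ (leaf-injective (trans (sym p) p′)))) (sym q′))
  rung-functional (i , inj₁ (p , q)) (i′ , inj₂ (p′ , q′)) = ⊥-elim (X≢Y i i′ (trans (sym p) p′))
  rung-functional (i , inj₂ (p , q)) (i′ , inj₁ (p′ , q′)) = ⊥-elim (X≢Y i′ i (trans (sym p′) p))
  rung-functional (i , inj₂ (p , q)) (i′ , inj₂ (p′ , q′)) =
    trans q (trans (cong X (Fin.↑ʳ-injective t _ _ (leaf-injective (trans (sym p) p′)))) (sym q′))

  path-meets-centre : ∀ {β₀ β₁ β₂} → Adjacent β₀ β₁ → Adjacent β₁ β₂ → β₀ ≢ β₂ →
    β₀ ≡ centre ⊎ β₁ ≡ centre ⊎ β₂ ≡ centre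
  path-meets-centre (inj₁ p)        _                 _ = inj₁ p
  path-meets-centre (inj₂ (inj₁ p)) _                 _ = inj₂ (inj₁ p)
  path-meets-centre _               (inj₁ p)          _ = inj₂ (inj₁ p)
  path-meets-centre _               (inj₂ (inj₁ p))   _ = inj₂ (inj₂ p)
  path-meets-centre (inj₂ (inj₂ r)) (inj₂ (inj₂ r′)) β₀≢β₂ = ⊥-elim (β₀≢β₂ (rung-functional (rung-sym r) r′))

  -- A path β₁ β₂ β₃ avoiding the centre at β₁, β₂ and not returning to β₁
  -- ends at the centre: a leaf is adjacent only to the centre and its partner.
  path-returns-to-centre : ∀ {β₁ β₂ β₃} → β₁ ≢ centre → Adjacent β₁ β₂ → β₂ ≢ centre →
    Adjacent β₂ β₃ → β₃ ≢ β₁ → β₃ ≡ centre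
  path-returns-to-centre β₁≢c (inj₁ p)        _    _                 _ = ⊥-elim (β₁≢c p)
  path-returns-to-centre _    (inj₂ (inj₁ p)) β₂≢c _                 _ = ⊥-elim (β₂≢c p)
  path-returns-to-centre _    (inj₂ (inj₂ r)) β₂≢c (inj₁ p)          _ = ⊥-elim (β₂≢c p)
  path-returns-to-centre _    (inj₂ (inj₂ r)) _    (inj₂ (inj₁ p))   _ = p
  path-returns-to-centre _    (inj₂ (inj₂ r)) _    (inj₂ (inj₂ r′)) β₃≢β₁ =
    ⊥-elim (β₃≢β₁ (rung-functional r′ (rung-sym r)))

  edge-view : ∀ {Q} → Q ∈ edgeList (friendship t e) → Σ Vertex λ u → Σ Vertex λ w → IsPair Q u w × Adjacent u w
  edge-view h with fork-view (spokes t e) h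
  ... | inj₁ (_ , h′ , refl) with ∈-map⁻ (λ ℓ → ⁅ ℓ ⁆ ++ ⊥ {n = e}) h′
  ...   | ℓ , _ , refl = centre , leaf ℓ , spoke , inj₁ refl
    where
    spoke : IsPair (inside ∷ (⁅ ℓ ⁆ ++ ⊥)) centre (leaf ℓ)
    spoke = record { u∈ = here ; w∈ = there (∈-++⁺ˡ ⁅ ℓ ⁆ ⊥ (x∈⁅x⁆ ℓ)) ; u≢w = λ () ; only = only }
      where
      only : ∀ y → y ∈ₛ (inside ∷ (⁅ ℓ ⁆ ++ ⊥)) → y ≡ centre ⊎ y ≡ leaf ℓ
      only zero    _         = inj₁ refl
      only (suc x) (there p) with split-view (t + t) e x
      ... | inj₁ (_ , refl) = inj₂ (cong leaf (x∈⁅y⁆⇒x≡y ℓ (∈-++⁻ˡ ⁅ ℓ ⁆ ⊥ p)))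
      ... | inj₂ (_ , refl) = ⊥-elim (∉⊥ (∈-++⁻ʳ ⁅ ℓ ⁆ ⊥ p))
  edge-view h | inj₂ (_ , h′ , refl) with ∈-map⁻ (λ i → (⁅ i ⁆ ++ ⁅ i ⁆) ++ ⊥ {n = e}) h′
  ...   | i , _ , refl = X i , Y i , rung , inj₂ (inj₂ (i , inj₁ (refl , refl)))
    where
    rung : IsPair (outside ∷ ((⁅ i ⁆ ++ ⁅ i ⁆) ++ ⊥)) (X i) (Y i)
    rung = record
      { u∈ = there (∈-++⁺ˡ (⁅ i ⁆ ++ ⁅ i ⁆) ⊥ (∈-++⁺ˡ ⁅ i ⁆ ⁅ i ⁆ (x∈⁅x⁆ i)))
      ; w∈ = there (∈-++⁺ˡ (⁅ i ⁆ ++ ⁅ i ⁆) ⊥ (∈-++⁺ʳ ⁅ i ⁆ ⁅ i ⁆ (x∈⁅x⁆ i)))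
      ; u≢w = X≢Y i i ; only = only }
      where
      only : ∀ y → y ∈ₛ (outside ∷ ((⁅ i ⁆ ++ ⁅ i ⁆) ++ ⊥)) → y ≡ X i ⊎ y ≡ Y i
      only (suc x) (there p) with split-view (t + t) e x
      ... | inj₂ (_ , refl) = ⊥-elim (∉⊥ (∈-++⁻ʳ (⁅ i ⁆ ++ ⁅ i ⁆) ⊥ p))
      ... | inj₁ (ℓ , refl) with split-view t t ℓ | ∈-++⁻ˡ (⁅ i ⁆ ++ ⁅ i ⁆) ⊥ p
      ...   | inj₁ (_ , refl) | p′ = inj₁ (cong X (x∈⁅y⁆⇒x≡y i (∈-++⁻ˡ ⁅ i ⁆ ⁅ i ⁆ p′)))
      ...   | inj₂ (_ , refl) | p′ = inj₂ (cong Y (x∈⁅y⁆⇒x≡y i (∈-++⁻ʳ ⁅ i ⁆ ⁅ i ⁆ p′)))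

  edge-adjacent : ∀ {Q u w} → IsPair Q u w → Adjacent u w → ∀ {β β′} → β ∈ₛ Q → β′ ∈ₛ Q → β ≢ β′ → Adjacent β β′
  edge-adjacent P uw {β} {β′} β∈ β′∈ β≢β′ with IsPair.only P β β∈ | IsPair.only P β′ β′∈
  ... | inj₁ refl | inj₁ refl = ⊥-elim (β≢β′ refl)
  ... | inj₂ refl | inj₂ refl = ⊥-elim (β≢β′ refl)
  ... | inj₁ refl | inj₂ refl = uw
  ... | inj₂ refl | inj₁ refl with uw
  ...   | inj₁ p        = inj₂ (inj₁ p)
  ...   | inj₂ (inj₁ p) = inj₁ p
  ...   | inj₂ (inj₂ r) = inj₂ (inj₂ (rung-sym r))

module Extension {j} (m : ℕ) (s : Tower j) where

  Vertex : Set
  Vertex = Fin (order (extend m s))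

  apex : Vertex
  apex = zero

  block : Fin m → Vertex
  block a = suc (a ↑ˡ order s)

  lower : Fin (order s) → Vertex
  lower y = suc (m ↑ʳ y)

  record ApexEdge (Q : Subset (order (extend m s))) : Set where
    field
      apex∈   : apex ∈ₛ Q
      a₁ a₂   : Fin m
      a₁≢a₂   : a₁ ≢ a₂
      block₁∈ : block a₁ ∈ₛ Q
      block₂∈ : block a₂ ∈ₛ Q

  record BlockEdge (Q : Subset (order (extend m s))) : Set where
    field
      apex∉   : ¬ (apex ∈ₛ Q)
      a       : Fin m
      block∈  : block a ∈ₛ Q
      block!  : ∀ a′ → block a′ ∈ₛ Q → a′ ≡ a
      base    : Subset (order s)
      base∈   : base ∈ edgeList s
      lower⁻  : ∀ y → lower y ∈ₛ Q → y ∈ₛ base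
      lower⁺  : ∀ y → y ∈ₛ base → lower y ∈ₛ Q

  edge-view : ∀ {Q} → Q ∈ edgeList (extend m s) → ApexEdge Q ⊎ BlockEdge Q
  edge-view h with fork-view (meetTwice m (order s) j) h
  ... | inj₁ (_ , h′ , refl) with meetTwice-mem m (order s) j h′
  ...   | a₁ , a₂ , a₁≢a₂ , a₁∈ , a₂∈ =
    inj₁ (record { apex∈ = here ; a₁ = a₁ ; a₂ = a₂ ; a₁≢a₂ = a₁≢a₂ ; block₁∈ = there a₁∈ ; block₂∈ = there a₂∈ })
  edge-view h | inj₂ (_ , h′ , refl) with ∈-cartesianProductWith⁻ attach (allFin m) (edgeList s) h′
  ...   | a , Q′ , _ , Q′∈ , refl = inj₂ (record
    { apex∉  = λ ()
    ; a      = a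
    ; block∈ = there (∈-++⁺ˡ ⁅ a ⁆ Q′ (x∈⁅x⁆ a))
    ; block! = λ { a′ (there p) → x∈⁅y⁆⇒x≡y a (∈-++⁻ˡ ⁅ a ⁆ Q′ p) }
    ; base   = Q′
    ; base∈  = Q′∈
    ; lower⁻ = λ { y (there p) → ∈-++⁻ʳ ⁅ a ⁆ Q′ p }
    ; lower⁺ = λ y p → there (∈-++⁺ʳ ⁅ a ⁆ Q′ p) })

mod-separates : ∀ L .{{_ : NonZero L}} s d → 0 < d → d < L → (s + d) % L ≢ s % L
mod-separates L s d 0<d d<L eq = shifted-residue (s % L) (m%n<n s L) reduced
  where
  reduced : (s % L + d) % L ≡ s % L
  reduced = trans (cong (λ z → (s % L + z) % L) (sym (m<n⇒m%n≡m d<L)))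
                  (trans (sym (%-distribˡ-+ s d L)) eq)
  shifted-residue : ∀ r → r < L → (r + d) % L ≢ r
  shifted-residue r r<L e with r + d <? L
  ... | yes r+d<L = <⇒≢ (m<m+n r 0<d) (trans (sym e) (m<n⇒m%n≡m r+d<L))
  ... | no  r+d≮L = <⇒≢ d<L (sym L≡d)
    where
    L≤r+d : L ≤ r + d
    L≤r+d = ≮⇒≥ r+d≮L
    w = r + d ∸ L
    L+w : L + w ≡ r + d
    L+w = m+[n∸m]≡n L≤r+d
    w<L : w < L
    w<L = +-cancelˡ-< L w L (subst (_< L + L) (sym L+w) (+-mono-< r<L d<L))
    w≡r : w ≡ r
    w≡r = trans (sym (m<n⇒m%n≡m w<L)) (trans (m≤n⇒[n∸m]%m≡n%m L≤r+d) e)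
    L≡d : L ≡ d
    L≡d = +-cancelˡ-≡ r L d (trans (+-comm r L) (trans (cong (L +_) (sym w≡r)) L+w))

-- Position p (any natural number) carries the vertex
-- V p = v (p mod L); window t consists of the positions t, …, t + k − 1.
module Windows {n k : ℕ} (m′ : ℕ) (v : Fin (suc m′) → Fin n) (v-injective : Injective _≡_ _≡_ v)
               (k≤m′ : k ≤ m′) (0<k : 0 < k) where

  L : ℕ
  L = suc m′

  V : ℕ → Fin n
  V p = v (p mod L)

  V-periodic : ∀ p → V (p + L) ≡ V p
  V-periodic p = cong v (Fin.fromℕ<-cong _ _ ([m+n]%n≡m%n p L) _ _)

  V-distinct : ∀ {p p′} → p < p′ → p′ ≤ p + m′ → V p′ ≢ V p
  V-distinct {p} {p′} p<p′ p′≤ eq = mod-separates L p (p′ ∸ p) (m<n⇒0<n∸m p<p′) d<L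
    (trans (cong (_% L) (m+[n∸m]≡n (<⇒≤ p<p′))) residues)
    where
    d<L : p′ ∸ p < L
    d<L = s≤s (≤-trans (∸-monoˡ-≤ p p′≤) (≤-reflexive (m+n∸m≡n p m′)))
    residues : p′ % L ≡ p % L
    residues = trans (sym (Fin.toℕ-fromℕ< _)) (trans (cong toℕ (v-injective eq)) (Fin.toℕ-fromℕ< _))

  within : ∀ {p p′} → p′ ≤ p + k → p′ ≤ p + m′
  within {p} p′≤ = ≤-trans p′≤ (+-monoʳ-≤ p k≤m′)

  InWindow : ℕ → Fin n → Set
  InWindow t x = Σ ℕ λ p → t ≤ p × p < t + k × V p ≡ x

  window-start : ∀ t {x} → V t ≡ x → InWindow t x
  window-start t eq = t , ≤-refl , m<m+n t 0<k , eq

  record WindowEdge {N} (E : List (Subset N)) (emb : Fin N → Fin n) (t : ℕ) : Set where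
    field
      edge     : Subset N
      edge∈    : edge ∈ E
      sound    : ∀ y → y ∈ₛ edge → InWindow t (emb y)
      complete : ∀ y → InWindow t (emb y) → y ∈ₛ edge

    at : ∀ {p y} → t ≤ p → p < t + k → V p ≡ emb y → y ∈ₛ edge
    at {p} {y} t≤p p<t+k eq = complete y (p , t≤p , p<t+k , eq)

  open WindowEdge

  Realises : ∀ {N} → List (Subset N) → (Fin N → Fin n) → Set
  Realises E emb = ∀ t → WindowEdge E emb t

  -- Then no window uses the apex, so each window contains exactly
  -- one block vertex and its lower vertices realise the windows in s.
  module ExtensionWindows {j} (m : ℕ) (s : Tower j) (emb : Fin (order (extend m s)) → Fin n)
           (emb-injective : Injective _≡_ _≡_ emb) (realised : Realises (edgeList (extend m s)) emb) where
    open Extension m s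

    -- An apex at position p would lie in window p, forcing an apex edge with
    -- two block vertices after p; window p + 1 can contain neither a second
    -- apex nor two block vertices.
    apex-absent : ∀ p → V p ≢ emb apex
    apex-absent p eq with edge-view (edge∈ (realised p)) | edge-view (edge∈ (realised (suc p)))
    ... | inj₂ b | _ = BlockEdge.apex∉ b (complete (realised p) apex (window-start p eq))
    ... | inj₁ a | inj₁ a′ with sound (realised (suc p)) apex (ApexEdge.apex∈ a′)
    ...   | p′ , p<p′ , p′≤p+k , eq′ = V-distinct p<p′ (within (s≤s⁻¹ p′≤p+k)) (trans eq′ (sym eq))
    apex-absent p eq | inj₁ a | inj₂ b = ApexEdge.a₁≢a₂ a
      (trans (BlockEdge.block! b _ (carry _ (ApexEdge.block₁∈ a))) (sym (BlockEdge.block! b _ (carry _ (ApexEdge.block₂∈ a)))))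
      where
      carry : ∀ a′ → block a′ ∈ₛ edge (realised p) → block a′ ∈ₛ edge (realised (suc p))
      carry a′ h with sound (realised p) (block a′) h
      ... | p₁ , p≤p₁ , p₁<p+k , eq₁ = at (realised (suc p)) (≤∧≢⇒< p≤p₁ p≢p₁) (m<n⇒m<1+n p₁<p+k) eq₁
        where
        p≢p₁ : p ≢ p₁
        p≢p₁ refl with emb-injective (trans (sym eq) eq₁)
        ... | ()

    window-is-block : ∀ t → BlockEdge (edge (realised t))
    window-is-block t with edge-view (edge∈ (realised t))
    ... | inj₂ b = b
    ... | inj₁ a with sound (realised t) apex (ApexEdge.apex∈ a)
    ...   | p , _ , _ , eq = ⊥-elim (apex-absent p eq)

    lower-realises : Realises (edgeList s) (emb ∘ lower)
    lower-realises t = record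
      { edge     = BlockEdge.base b
      ; edge∈    = BlockEdge.base∈ b
      ; sound    = λ y y∈ → sound (realised t) (lower y) (BlockEdge.lower⁺ b y y∈)
      ; complete = λ y w → BlockEdge.lower⁻ b y (complete (realised t) (lower y) w) }
      where b = window-is-block t

    lower-injective : Injective _≡_ _≡_ (emb ∘ lower)
    lower-injective eq = Fin.↑ʳ-injective m _ _ (Fin.suc-injective (emb-injective eq))

    blockOf : ℕ → Fin m
    blockOf t = BlockEdge.a (window-is-block t)

    blockOf-occurs : ∀ t → InWindow t (emb (block (blockOf t)))
    blockOf-occurs t = sound (realised t) _ (BlockEdge.block∈ (window-is-block t))

    blockOf-unique : ∀ t {p a} → t ≤ p → p < t + k → V p ≡ emb (block a) → a ≡ blockOf t
    blockOf-unique t {a = a} t≤p p<t+k eq = BlockEdge.block! (window-is-block t) a (at (realised t) t≤p p<t+k eq)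

    block-separated : ∀ {p p′ a a′} → p < p′ → p′ ≤ p + k → V p ≡ emb (block a) → V p′ ≡ emb (block a′) → a′ ≢ a
    block-separated p<p′ p′≤p+k eq eq′ refl = V-distinct p<p′ (within p′≤p+k) (trans eq′ (sym eq))

    -- The walk is at least twice as long as a window: the block vertex a of
    -- window 0, at position p, is followed by the block vertex of window
    -- p + 1 exactly at p + k; if L < 2k, window p + k would see a again at p + L.
    long-period : k + k ≤ L
    long-period with blockOf-occurs 0
    ... | p , _ , _ , eq with blockOf-occurs (suc p)
    ... | p₂ , p<p₂ , p₂<p+k+1 , eq₂ = ≮⇒≥ short
      where
      a≡ : ∀ {a} → V p ≡ emb (block a) → a ≡ blockOf p
      a≡ e = blockOf-unique p ≤-refl (m<m+n p 0<k) e
      p₂≡p+k : p₂ ≡ p + k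
      p₂≡p+k with p₂ <? p + k
      ... | no  p₂≮p+k = ≤-antisym (s≤s⁻¹ p₂<p+k+1) (≮⇒≥ p₂≮p+k)
      ... | yes p₂<p+k = ⊥-elim (block-separated p<p₂ (<⇒≤ p₂<p+k) eq eq₂
              (trans (blockOf-unique p (<⇒≤ p<p₂) p₂<p+k eq₂) (sym (a≡ eq))))
      short : L < k + k → Void
      short L<2k = block-separated p<p₂ (s≤s⁻¹ p₂<p+k+1) eq eq₂ (trans (blockOf-unique (p + k) p+k≤p₂ p₂<p+2k eq₂)
                     (sym (blockOf-unique (p + k) (+-monoʳ-≤ p k≤L) p+L<p+2k (trans (V-periodic p) eq))))
        where
        k≤L : k ≤ L
        k≤L = m≤n⇒m≤1+n k≤m′
        p+k≤p₂ : p + k ≤ p₂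
        p+k≤p₂ = ≤-reflexive (sym p₂≡p+k)
        p₂<p+2k : p₂ < p + k + k
        p₂<p+2k = subst (_< p + k + k) (sym p₂≡p+k) (m<m+n (p + k) 0<k)
        p+L<p+2k : p + L < p + k + k
        p+L<p+2k = subst (p + L <_) (sym (+-assoc p k k)) (+-monoʳ-< p L<2k)

  module FriendshipWindows (t e : ℕ) (emb : Fin (order (friendship t e)) → Fin n)
           (emb-injective : Injective _≡_ _≡_ emb) (realised : Realises (edgeList (friendship t e)) emb)
           (long : k + k ≤ L) where
    open Friendship t e

    window-pair : ∀ q → Σ Vertex λ u → Σ Vertex λ w → IsPair (edge (realised q)) u w × Adjacent u w
    window-pair q = edge-view (edge∈ (realised q))

    adjacent-in : ∀ q {β β′} → β ∈ₛ edge (realised q) → β′ ∈ₛ edge (realised q) → β ≢ β′ → Adjacent β β′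
    adjacent-in q with window-pair q
    ... | _ , _ , P , uw = edge-adjacent P uw

    partner-in : ∀ q {β} → β ∈ₛ edge (realised q) →
      Σ Vertex λ o → o ∈ₛ edge (realised q) × o ≢ β × (∀ y → y ∈ₛ edge (realised q) → y ≡ β ⊎ y ≡ o)
    partner-in q with window-pair q
    ... | _ , _ , P , _ = partner P

    distinct-at : ∀ {p p′ y y′} → p < p′ → p′ ≤ p + m′ → V p ≡ emb y → V p′ ≡ emb y′ → y′ ≢ y
    distinct-at p<p′ p′≤ eq eq′ refl = V-distinct p<p′ p′≤ (trans eq′ (sym eq))

    record NextVertex (q : ℕ) (b₁ : Vertex) : Set where
      field
        b₂    : Vertex
        at-q+k : V (q + k) ≡ emb b₂
        adj   : Adjacent b₁ b₂
        b₂≢b₁ : b₂ ≢ b₁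

    next-vertex : ∀ q p₁ b₀ b₁ → q < p₁ → p₁ < q + k → V q ≡ emb b₀ → V p₁ ≡ emb b₁ →
      (∀ y → y ∈ₛ edge (realised q) → y ≡ b₀ ⊎ y ≡ b₁) → NextVertex q b₁
    next-vertex q p₁ b₀ b₁ q<p₁ p₁<q+k eq₀ eq₁ only with partner-in (suc q) (at (realised (suc q)) q<p₁ (m<n⇒m<1+n p₁<q+k) eq₁)
    ... | b₂ , b₂∈ , b₂≢b₁ , _ with sound (realised (suc q)) b₂ b₂∈
    ... | p₂ , q<p₂ , p₂<q+k+1 , eq₂ = record
      { b₂ = b₂ ; at-q+k = trans (cong V (sym p₂≡q+k)) eq₂
      ; adj = adjacent-in (suc q) (at (realised (suc q)) q<p₁ (m<n⇒m<1+n p₁<q+k) eq₁) b₂∈ (λ eq → b₂≢b₁ (sym eq))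
      ; b₂≢b₁ = b₂≢b₁ }
      where
      p₂≡q+k : p₂ ≡ q + k
      p₂≡q+k with p₂ <? q + k
      ... | no  p₂≮q+k = ≤-antisym (s≤s⁻¹ p₂<q+k+1) (≮⇒≥ p₂≮q+k)
      ... | yes p₂<q+k with only b₂ (at (realised q) (<⇒≤ q<p₂) p₂<q+k eq₂)
      ...   | inj₁ b₂≡b₀ = ⊥-elim (distinct-at q<p₂ (within (<⇒≤ p₂<q+k)) eq₀ eq₂ b₂≡b₀)
      ...   | inj₂ b₂≡b₁ = ⊥-elim (b₂≢b₁ b₂≡b₁)

    exhausted-in : ∀ q {β β′} → β ∈ₛ edge (realised q) → β′ ∈ₛ edge (realised q) → β ≢ β′ →
      ∀ y → y ∈ₛ edge (realised q) → y ≡ β ⊎ y ≡ β′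
    exhausted-in q with window-pair q
    ... | _ , _ , P , _ = pair-exhausted P

    -- Starting from b₀ at position q, the windows q, q + 1, p₁ + 1 force a
    -- path b₀ b₁ b₂ b₃ at positions q < p₁ < q + k < p₁ + k.
    record Ladder (q : ℕ) (b₀ : Vertex) : Set where
      field
        p₁         : ℕ
        q<p₁       : q < p₁
        p₁<q+k     : p₁ < q + k
        b₁ b₂ b₃   : Vertex
        at-p₁      : V p₁ ≡ emb b₁
        at-q+k     : V (q + k) ≡ emb b₂
        at-p₁+k    : V (p₁ + k) ≡ emb b₃
        adj₀₁      : Adjacent b₀ b₁
        adj₁₂      : Adjacent b₁ b₂
        adj₂₃      : Adjacent b₂ b₃

    ladder : ∀ q b₀ → V q ≡ emb b₀ → Ladder q b₀
    ladder q b₀ eq₀ with partner-in q b₀∈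
      where b₀∈ = at (realised q) ≤-refl (m<m+n q 0<k) eq₀
    ... | b₁ , b₁∈ , b₁≢b₀ , only with sound (realised q) b₁ b₁∈
    ... | p₁ , q≤p₁ , p₁<q+k , eq₁ = record
      { p₁ = p₁ ; q<p₁ = q<p₁ ; p₁<q+k = p₁<q+k ; b₁ = b₁ ; b₂ = NextVertex.b₂ N₁ ; b₃ = NextVertex.b₂ N₂
      ; at-p₁ = eq₁ ; at-q+k = NextVertex.at-q+k N₁ ; at-p₁+k = NextVertex.at-q+k N₂
      ; adj₀₁ = adjacent-in q (at (realised q) ≤-refl (m<m+n q 0<k) eq₀) b₁∈ (λ eq → b₁≢b₀ (sym eq))
      ; adj₁₂ = NextVertex.adj N₁ ; adj₂₃ = NextVertex.adj N₂ }
      where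
      q<p₁ : q < p₁
      q<p₁ = ≤∧≢⇒< q≤p₁ (λ q≡p₁ → b₁≢b₀ (emb-injective (trans (sym eq₁) (trans (cong V (sym q≡p₁)) eq₀))))
      N₁ = next-vertex q p₁ b₀ b₁ q<p₁ p₁<q+k eq₀ eq₁ only
      q+k<p₁+k : q + k < p₁ + k
      q+k<p₁+k = +-monoˡ-< k q<p₁
      window-p₁ : ∀ y → y ∈ₛ edge (realised p₁) → y ≡ b₁ ⊎ y ≡ NextVertex.b₂ N₁
      window-p₁ = exhausted-in p₁ (at (realised p₁) ≤-refl (m<m+n p₁ 0<k) eq₁)
        (at (realised p₁) (<⇒≤ p₁<q+k) q+k<p₁+k (NextVertex.at-q+k N₁)) (λ eq → NextVertex.b₂≢b₁ N₁ (sym eq))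
      N₂ = next-vertex p₁ (q + k) b₁ (NextVertex.b₂ N₁) p₁<q+k q+k<p₁+k eq₁ (NextVertex.at-q+k N₁) window-p₁

    -- The centre never occurs: from the centre at q, the ladder leads back to
    -- the centre at p₁ + k, less than L positions later.
    centre-absent : ∀ q → V q ≢ emb centre
    centre-absent q eq = distinct-at (<-≤-trans q<p₁ (m≤m+n p₁ k)) far eq at-p₁+k b₃≡centre
      where
      open Ladder (ladder q centre eq)
      b₃≡centre : b₃ ≡ centre
      b₃≡centre = path-returns-to-centre
        (distinct-at q<p₁ (within (<⇒≤ p₁<q+k)) eq at-p₁) adj₁₂
        (distinct-at (m<m+n q 0<k) (within ≤-refl) eq at-q+k) adj₂₃
        (distinct-at (m<m+n p₁ 0<k) (within ≤-refl) at-p₁ at-p₁+k)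
      far : p₁ + k ≤ q + m′
      far = s≤s⁻¹ (begin-strict
        p₁ + k       <⟨ +-monoˡ-< k p₁<q+k ⟩
        q + k + k    ≡⟨ +-assoc q k k ⟩
        q + (k + k)  ≤⟨ +-monoʳ-≤ q long ⟩
        q + L        ≡⟨ +-suc q m′ ⟩
        suc (q + m′) ∎)
        where open ≤-Reasoning

    -- But the path b₀ b₁ b₂ of a ladder has distinct ends, so it passes
    -- through the centre.
    ladder-impossible : ∀ {q b₀} → V q ≡ emb b₀ → Ladder q b₀ → Void
    ladder-impossible {q} {b₀} eq₀ ℓ = centre-on-path (path-meets-centre adj₀₁ adj₁₂ b₀≢b₂)
      where
      open Ladder ℓ
      b₀≢b₂ : b₀ ≢ b₂
      b₀≢b₂ b₀≡b₂ = distinct-at (m<m+n q 0<k) (within ≤-refl) eq₀ at-q+k (sym b₀≡b₂)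
      centre-on-path : b₀ ≡ centre ⊎ b₁ ≡ centre ⊎ b₂ ≡ centre → Void
      centre-on-path (inj₁ b₀≡c)        = centre-absent q (trans eq₀ (cong emb b₀≡c))
      centre-on-path (inj₂ (inj₁ b₁≡c)) = centre-absent p₁ (trans at-p₁ (cong emb b₁≡c))
      centre-on-path (inj₂ (inj₂ b₂≡c)) = centre-absent (q + k) (trans at-q+k (cong emb b₂≡c))

    no-walk : Void
    no-walk with window-pair 0
    ... | u , _ , P , _ with sound (realised 0) u (IsPair.u∈ P)
    ... | q , _ , _ , eq = ladder-impossible eq (ladder q u eq)

  -- Descending through the extensions down to the friendship graph: no
  -- tower realises the windows of a walk of length at least 2k, and for a
  -- tower whose top is an extension the length condition is automatic.
  tower-unrealisable : ∀ {j} (s : Tower j) (emb : Fin (order s) → Fin n) → Injective _≡_ _≡_ emb →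
    Realises (edgeList s) emb → k + k ≤ L → Void
  tower-unrealisable (friendship t e) emb emb-inj realised long = FriendshipWindows.no-walk t e emb emb-inj realised long
  tower-unrealisable (extend m s) emb emb-inj realised long =
    tower-unrealisable s (emb ∘ lower) lower-injective lower-realises long
    where
    open Extension m s using (lower)
    open ExtensionWindows m s emb emb-inj realised

  extension-unrealisable : ∀ {j} m (s : Tower j) (emb : Fin (order (extend m s)) → Fin n) → Injective _≡_ _≡_ emb →
    Realises (edgeList (extend m s)) emb → Void
  extension-unrealisable m s emb emb-inj realised =
    tower-unrealisable (extend m s) emb emb-inj realised long-period
    where open ExtensionWindows m s emb emb-inj realised

  mod-shift : ∀ i d → (toℕ (i mod L) + d) mod L ≡ (i + d) mod L
  mod-shift i d = Fin.fromℕ<-cong _ _ residues _ _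
    where
    residues : (toℕ (i mod L) + d) % L ≡ (i + d) % L
    residues = begin
      (toℕ (i mod L) + d) % L  ≡⟨ cong (λ z → (z + d) % L) (Fin.toℕ-fromℕ< (m%n<n i L)) ⟩
      (i % L + d) % L          ≡⟨ %-distribˡ-+ (i % L) d L ⟩
      (i % L % L + d % L) % L  ≡⟨ cong (λ z → (z + d % L) % L) (m%n%n≡m%n i L) ⟩
      (i % L + d % L) % L      ≡⟨ %-distribˡ-+ i d L ⟨
      (i + d) % L              ∎
      where open ≡-Reasoning

  cycle-realises : (E : List (Subset n)) →
    ((i : Fin L) → Σ (Subset n) λ S → S ∈ E ×
       ((x : Fin n) → (x ∈ₛ S → ∃ λ (d : Fin k) → v ((toℕ i + toℕ d) mod L) ≡ x)
                    × ((∃ λ (d : Fin k) → v ((toℕ i + toℕ d) mod L) ≡ x) → x ∈ₛ S))) →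
    Realises E id
  cycle-realises E tight t = record { edge = S ; edge∈ = S∈ ; sound = sound′ ; complete = complete′ }
    where
    S = proj₁ (tight (t mod L))
    S∈ = proj₁ (proj₂ (tight (t mod L)))
    spans = proj₂ (proj₂ (tight (t mod L)))
    sound′ : ∀ x → x ∈ₛ S → InWindow t x
    sound′ x x∈ with proj₁ (spans x) x∈
    ... | d , eq = t + toℕ d , m≤m+n t _ , +-monoʳ-< t (Fin.toℕ<n d) , trans (cong v (sym (mod-shift t (toℕ d)))) eq
    complete′ : ∀ x → InWindow t x → x ∈ₛ S
    complete′ x (p , t≤p , p<t+k , eq) = proj₂ (spans x) (fromℕ< d<k , trans (cong v position) eq)
      where
      d<k : p ∸ t < k
      d<k = +-cancelˡ-< t _ _ (subst (_< t + k) (sym (m+[n∸m]≡n t≤p)) p<t+k)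
      position : (toℕ (t mod L) + toℕ (fromℕ< d<k)) mod L ≡ p mod L
      position = begin
        (toℕ (t mod L) + toℕ (fromℕ< d<k)) mod L ≡⟨ cong (λ z → (toℕ (t mod L) + z) mod L) (Fin.toℕ-fromℕ< d<k) ⟩
        (toℕ (t mod L) + (p ∸ t)) mod L          ≡⟨ mod-shift t (p ∸ t) ⟩
        (t + (p ∸ t)) mod L                      ≡⟨ cong (_mod L) (m+[n∸m]≡n t≤p) ⟩
        p mod L                                  ∎
        where open ≡-Reasoning

extension-tight-cycle-free : ∀ {j} m (s : Tower j) → TightCycleFree (towerGraph (extend m s))
extension-tight-cycle-free m s (m′ , k≤m′ , v , v-injective , tight) =
  extension-unrealisable m s id id (cycle-realises (edgeList (extend m s)) tight)
  where open Windows m′ v v-injective k≤m′ (s≤s z≤n)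

binom-succ-bound : ∀ n r → binom (suc n) (suc r) ≤ suc n * binom n r
binom-succ-bound n r = begin
  binom (suc n) (suc r)          ≤⟨ m≤n*m _ (suc r) ⟩
  suc r * binom (suc n) (suc r)  ≡⟨ binom-absorb n r ⟩
  suc n * binom n r              ∎
  where open ≤-Reasoning

-- Consecutive binomial coefficients grow by the factor (n − r)/(r + 1):
-- if (c + 1)(r + 1) ≤ n + 1 then c·C(n, r) ≤ C(n, r + 1).
binom-ratio : ∀ c n r → (c + 1) * suc r ≤ suc n → c * binom n r ≤ binom n (suc r)
binom-ratio c n r big = *-cancelˡ-≤ (suc r) (+-cancelʳ-≤ (suc r * binom n r) _ _ (begin
    suc r * (c * binom n r) + suc r * binom n r   ≡⟨ regroup (suc r) c (binom n r) ⟩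
    (c + 1) * suc r * binom n r                   ≤⟨ *-monoˡ-≤ (binom n r) big ⟩
    suc n * binom n r                             ≡⟨ binom-absorb n r ⟨
    suc r * binom (suc n) (suc r)                 ≡⟨ *-distribˡ-+ (suc r) (binom n r) (binom n (suc r)) ⟩
    suc r * binom n r + suc r * binom n (suc r)   ≡⟨ +-comm (suc r * binom n r) _ ⟩
    suc r * binom n (suc r) + suc r * binom n r   ∎))
  where
  open ≤-Reasoning
  regroup : ∀ x y z → x * (y * z) + x * z ≡ (y + 1) * x * z
  regroup = solve-∀

-- By meetTwice-length,
--   B = C(m + b, r + 1) = Z + C(b, r + 1) + m·(C(b₁, r − 1) + C(b₁, r)),
-- while the extension has Z + m·D edges.  The surplus m·D − m·C(b₁, r) ≥
-- m·C(b₁, r)/c dominates the error terms C(b, r + 1), m·C(b₁, r − 1) and B/Q,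
-- so the extension has at least (1 + 1/Q)·B edges, Q = 4c·λ^r.
module ExtensionDensity (c r₀ m b₁ D lam : ℕ) (0<c : 0 < c)
  (s-dense     : suc c * binom b₁ (suc r₀) ≤ c * D)
  (block-large : 4 * c * suc b₁ ≤ m)
  (s-large     : (4 * c + 1) * suc r₀ ≤ suc b₁)
  (block-small : m + b₁ ≤ lam * (b₁ ∸ suc r₀)) where

  r b X C₀ T B Z Q : ℕ
  r  = suc r₀
  b  = suc b₁
  X  = binom b₁ r
  C₀ = binom b₁ r₀
  T  = binom b (suc r)
  B  = binom (m + b) (suc r)
  Z  = length (meetTwice m b (suc r))
  Q  = 4 * c * lam ^ r

  open ≤-Reasoning

  lower-error : 4 * (c * Q * m * C₀) ≤ Q * m * X
  lower-error = begin
    4 * (c * Q * m * C₀)  ≡⟨ regroup c Q m C₀ ⟩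
    Q * m * (4 * c * C₀)  ≤⟨ *-monoʳ-≤ (Q * m) (binom-ratio (4 * c) b₁ r₀ s-large) ⟩
    Q * m * X             ∎
    where
    regroup : ∀ x y z w → 4 * (x * y * z * w) ≡ y * z * (4 * x * w)
    regroup = solve-∀

  top-error : 4 * (c * Q * T) ≤ Q * m * X
  top-error = begin
    4 * (c * Q * T)        ≤⟨ *-monoʳ-≤ 4 (*-monoʳ-≤ (c * Q) (binom-succ-bound b₁ r)) ⟩
    4 * (c * Q * (b * X))  ≡⟨ regroup c Q b X ⟩
    Q * (4 * c * b) * X    ≤⟨ *-monoˡ-≤ X (*-monoʳ-≤ Q block-large) ⟩
    Q * m * X              ∎
    where
    regroup : ∀ x y z w → 4 * (x * y * (z * w)) ≡ y * (4 * x * z) * w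
    regroup = solve-∀

  -- B ≤ (m + b)·C(m + b₁, r) ≤ 2m·λ^r·C(b₁, r).
  scale-error : 2 * (c * B) ≤ Q * m * X
  scale-error = begin
    2 * (c * B)                           ≤⟨ *-monoʳ-≤ 2 (*-monoʳ-≤ c B≤) ⟩
    2 * (c * ((m + m) * (lam ^ r * X)))   ≡⟨ regroup c m (lam ^ r) X ⟩
    Q * m * X                             ∎
    where
    b≤m : b ≤ m
    b≤m = ≤-trans (m≤n*m b (4 * c) {{ >-nonZero (*-mono-< {0} {4} {0} {c} (s≤s z≤n) 0<c) }}) block-large
    B≤ : B ≤ (m + m) * (lam ^ r * X)
    B≤ = begin
      binom (m + suc b₁) (suc r)    ≡⟨ cong (λ z → binom z (suc r)) (+-suc m b₁) ⟩
      binom (suc (m + b₁)) (suc r)  ≤⟨ binom-succ-bound (m + b₁) r ⟩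
      suc (m + b₁) * binom (m + b₁) r
        ≤⟨ *-mono-≤ (≤-trans (≤-reflexive (sym (+-suc m b₁))) (+-monoʳ-≤ m b≤m)) (binom-scale lam r b₁ (m + b₁) block-small) ⟩
      (m + m) * (lam ^ r * X)       ∎
    regroup : ∀ x y z w → 2 * (x * ((y + y) * (z * w))) ≡ 4 * x * z * y * w
    regroup = solve-∀

  errors : c * B + c * Q * T + c * Q * m * C₀ ≤ Q * m * X
  errors = *-cancelˡ-≤ 4 (begin
    4 * (c * B + c * Q * T + c * Q * m * C₀)                 ≡⟨ expand (c * B) (c * Q * T) (c * Q * m * C₀) ⟩
    2 * (2 * (c * B)) + 4 * (c * Q * T) + 4 * (c * Q * m * C₀)
      ≤⟨ +-mono-≤ (+-mono-≤ (*-monoʳ-≤ 2 scale-error) top-error) lower-error ⟩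
    2 * (Q * m * X) + Q * m * X + Q * m * X                  ≡⟨ collect (Q * m * X) ⟩
    4 * (Q * m * X)                                          ∎)
    where
    expand : ∀ x y z → 4 * (x + y + z) ≡ 2 * (2 * x) + 4 * y + 4 * z
    expand = solve-∀
    collect : ∀ x → 2 * x + x + x ≡ 4 * x
    collect = solve-∀

  instance
    c-nonZero : NonZero c
    c-nonZero = >-nonZero 0<c

  surplus : B + Q * T + Q * m * C₀ + Q * m * X ≤ Q * m * D
  surplus = *-cancelˡ-≤ c (begin
    c * (B + Q * T + Q * m * C₀ + Q * m * X)       ≡⟨ expand c B Q T m C₀ X ⟩
    (c * B + c * Q * T + c * Q * m * C₀) + c * (Q * m * X) ≤⟨ +-monoˡ-≤ _ errors ⟩
    Q * m * X + c * (Q * m * X)                    ≡⟨ collect Q m X c ⟩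
    Q * m * (suc c * X)                            ≤⟨ *-monoʳ-≤ (Q * m) s-dense ⟩
    Q * m * (c * D)                                ≡⟨ swap Q m c D ⟩
    c * (Q * m * D)                                ∎)
    where
    expand : ∀ q x y t m′ c′ z → q * (x + y * t + y * m′ * c′ + y * m′ * z) ≡ (q * x + q * y * t + q * y * m′ * c′) + q * (y * m′ * z)
    expand = solve-∀
    collect : ∀ y m′ z q → y * m′ * z + q * (y * m′ * z) ≡ y * m′ * ((1 + q) * z)
    collect = solve-∀
    swap : ∀ y m′ q d → y * m′ * (q * d) ≡ q * (y * m′ * d)
    swap = solve-∀

  dense : suc Q * B ≤ Q * (Z + m * D)
  dense = begin
    B + Q * B                                      ≡⟨ cong (λ z → B + Q * z) (sym (meetTwice-length m b r)) ⟩
    B + Q * (Z + T + m * (C₀ + X))                 ≡⟨ expand B Q Z T m C₀ X ⟩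
    (B + Q * T + Q * m * C₀ + Q * m * X) + Q * Z   ≤⟨ +-monoˡ-≤ (Q * Z) surplus ⟩
    Q * m * D + Q * Z                              ≡⟨ collect Q m D Z ⟩
    Q * (Z + m * D)                                ∎
    where
    expand : ∀ x q z t m′ c′ y → x + q * (z + t + m′ * (c′ + y)) ≡ (x + q * t + q * m′ * c′ + q * m′ * y) + q * z
    expand = solve-∀
    collect : ∀ q m′ d z → q * m′ * d + q * z ≡ q * (z + m′ * d)
    collect = solve-∀

Dense : ℕ → Set
Dense j = Σ ℕ λ Q → 0 < Q × Σ ℕ λ N → ∀ b → N ≤ b →
  Σ (Tower j) λ s → order s ≡ b × suc Q * binom (b ∸ 1) (j ∸ 1) ≤ Q * size s

halve : ∀ x → Σ ℕ λ t → Σ ℕ λ e → e ≤ 1 × (t + t) + e ≡ x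
halve zero          = 0 , 0 , z≤n , refl
halve (suc zero)    = 0 , 1 , s≤s z≤n , refl
halve (suc (suc x)) with halve x
... | t , e , e≤1 , eq = suc t , e , e≤1 , cong suc (trans (cong (_+ e) (+-suc t t)) (cong suc eq))

friendship-ratio : ∀ t e → e ≤ 1 → 8 ≤ (t + t) + e → 4 * ((t + t) + e) ≤ 3 * ((t + t) + t)
friendship-ratio t e e≤1 8≤ = begin
  4 * ((t + t) + e)  ≤⟨ *-monoʳ-≤ 4 (+-monoʳ-≤ (t + t) e≤1) ⟩
  4 * ((t + t) + 1)  ≡⟨ expand t ⟩
  8 * t + 4          ≤⟨ +-monoʳ-≤ (8 * t) 4≤t ⟩
  8 * t + t          ≡⟨ collect t ⟩
  3 * ((t + t) + t)  ∎
  where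
  open ≤-Reasoning
  expand : ∀ t → 4 * ((t + t) + 1) ≡ 8 * t + 4
  expand = solve-∀
  collect : ∀ t → 8 * t + t ≡ 3 * ((t + t) + t)
  collect = solve-∀
  4≤t : 4 ≤ t
  4≤t with 4 ≤? t
  ... | yes 4≤t = 4≤t
  ... | no  4≰t = ⊥-elim (<-irrefl refl (≤-trans 8≤ (+-mono-≤ (+-mono-≤ t≤3 t≤3) e≤1)))
    where
    t≤3 : t ≤ 3
    t≤3 = s≤s⁻¹ (≰⇒> 4≰t)

friendship-dense : Dense 2
friendship-dense = 3 , s≤s z≤n , 9 , tower
  where
  tower : ∀ b → 9 ≤ b → Σ (Tower 2) λ s → order s ≡ b × 4 * binom (b ∸ 1) 1 ≤ 3 * size s
  tower (suc b₁) (s≤s 8≤b₁) with halve b₁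
  ... | t , e , e≤1 , eq = friendship t e , cong suc eq ,
    subst₂ (λ u w → 4 * u ≤ 3 * w) (trans eq (sym (binom-1 b₁))) (sym (size-friendship t e))
      (friendship-ratio t e e≤1 (subst (8 ≤_) (sym eq) 8≤b₁))

quotient-bounds : ∀ x L .{{_ : NonZero L}} → (x / L) * L ≤ x × x < suc (x / L) * L
quotient-bounds x L = m/n*n≤m x L , (begin-strict
  x                      ≡⟨ m≡m%n+[m/n]*n x L ⟩
  x % L + (x / L) * L    <⟨ +-monoˡ-< ((x / L) * L) (m%n<n x L) ⟩
  L + (x / L) * L        ∎)
  where open ≤-Reasoning

-- With L = 4c + 2 and b·L ≤ x < (b + 1)·L, a block of m = x − b vertices
-- over a tower of order b = b₁ + 1 is large (4c·b ≤ m) but not too large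
-- (m + b₁ ≤ 2L·(b₁ − r)) once b ≥ 2r + 3.
block-large-cond : ∀ c b x → b * (4 * c + 2) ≤ x → 4 * c * b ≤ x ∸ b
block-large-cond c b x bL≤x = m+n≤o⇒m≤o∸n (4 * c * b) (≤-trans (m≤m+n (4 * c * b + b) b) (≤-trans (≤-reflexive (collect c b)) bL≤x))
  where
  collect : ∀ c b → 4 * c * b + b + b ≡ b * (4 * c + 2)
  collect = solve-∀

block-small-cond : ∀ c r b₁ x → r + r + 3 ≤ suc b₁ → suc b₁ ≤ x → x < suc (suc b₁) * (4 * c + 2) →
  (x ∸ suc b₁) + b₁ ≤ 2 * (4 * c + 2) * (b₁ ∸ r)
block-small-cond c r b₁ x 2r+3≤b b≤x x<[b+1]L = begin
  (x ∸ suc b₁) + b₁              ≤⟨ +-monoʳ-≤ (x ∸ suc b₁) (n≤1+n b₁) ⟩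
  (x ∸ suc b₁) + suc b₁          ≡⟨ m∸n+n≡m b≤x ⟩
  x                              ≤⟨ <⇒≤ x<[b+1]L ⟩
  suc (suc b₁) * (4 * c + 2)     ≤⟨ *-monoˡ-≤ (4 * c + 2) b+1≤2d ⟩
  2 * d * (4 * c + 2)            ≡⟨ swap d (4 * c + 2) ⟩
  2 * (4 * c + 2) * d            ∎
  where
  open ≤-Reasoning
  d = b₁ ∸ r
  r+r+2≤b₁ : r + r + 2 ≤ b₁
  r+r+2≤b₁ = s≤s⁻¹ (subst (_≤ suc b₁) (+-suc (r + r) 2) 2r+3≤b)
  r+2≤d : r + 2 ≤ d
  r+2≤d = m+n≤o⇒m≤o∸n (r + 2) (subst (_≤ b₁) (reorder r) r+r+2≤b₁)
    where
    reorder : ∀ r → r + r + 2 ≡ r + 2 + r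
    reorder = solve-∀
  b+1≤2d : suc (suc b₁) ≤ 2 * d
  b+1≤2d = begin
    suc (suc b₁)       ≡⟨ cong (λ z → suc (suc z)) (sym (m∸n+n≡m (≤-trans (m≤n+m r r) (≤-trans (m≤m+n (r + r) 2) r+r+2≤b₁)))) ⟩
    suc (suc (d + r))  ≡⟨ reorder d r ⟩
    d + (r + 2)        ≤⟨ +-monoʳ-≤ d r+2≤d ⟩
    d + d              ≡⟨ cong (d +_) (sym (+-identityʳ d)) ⟩
    2 * d              ∎
    where
    reorder : ∀ d r → suc (suc (d + r)) ≡ d + (r + 2)
    reorder = solve-∀
  swap : ∀ d l → 2 * d * l ≡ 2 * l * d
  swap = solve-∀

-- Density propagates up one uniformity: extend a dense tower of order
-- b ≈ n / (4c + 2) by a block of the remaining n − 1 − b vertices.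
extension-dense : ∀ r₀ → Dense (suc (suc r₀)) → Dense (suc (suc (suc r₀)))
extension-dense r₀ (c , 0<c , N′ , dense-below) = Q , 0<Q , suc (T * Lq) , tower
  where
  r Lq lam Q T : ℕ
  r   = suc r₀
  Lq  = 4 * c + 2
  lam = 2 * Lq
  Q   = 4 * c * lam ^ r
  T   = (r + r + 3) + N′ + (4 * c + 1) * r

  0<Lq : 0 < Lq
  0<Lq = ≤-trans (s≤s z≤n) (m≤n+m 2 (4 * c))

  instance
    Lq-nonZero : NonZero Lq
    Lq-nonZero = >-nonZero 0<Lq
    lam-nonZero : NonZero lam
    lam-nonZero = >-nonZero (*-mono-< {0} {2} {0} {Lq} (s≤s z≤n) 0<Lq)

  0<Q : 0 < Q
  0<Q = *-mono-< {0} {4 * c} {0} (*-mono-< {0} {4} {0} {c} (s≤s z≤n) 0<c) (m^n>0 lam r)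

  extended : ∀ x b → b * Lq ≤ x → x < suc b * Lq → T ≤ b →
    Σ (Tower (suc (suc (suc r₀)))) λ s → order s ≡ suc x × suc Q * binom x (suc r) ≤ Q * size s
  extended x (suc b₁) bL≤x x<[b+1]L T≤b = extend m s , cong suc (trans (cong (m +_) order≡b) m+b≡x) , many
    where
    b = suc b₁
    tower-s = dense-below b (≤-trans (m≤n+m N′ (r + r + 3)) (≤-trans (m≤m+n _ _) T≤b))
    s = proj₁ tower-s
    order≡b = proj₁ (proj₂ tower-s)
    m = x ∸ b
    b≤x : b ≤ x
    b≤x = ≤-trans (m≤m*n b Lq) bL≤x
    m+b≡x : m + b ≡ x
    m+b≡x = m∸n+n≡m b≤x
    module Count = ExtensionDensity c r₀ m b₁ (size s) lam 0<c (proj₂ (proj₂ tower-s)) (block-large-cond c b x bL≤x)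
      (≤-trans (m≤n+m _ (r + r + 3 + N′)) T≤b)
      (block-small-cond c r b₁ x (≤-trans (m≤m+n (r + r + 3) _) (≤-trans (m≤m+n _ _) T≤b)) b≤x x<[b+1]L)
    many : suc Q * binom x (suc r) ≤ Q * size (extend m s)
    many = subst₂ (λ u w → suc Q * binom u (suc r) ≤ Q * w) m+b≡x
      (trans (cong (λ z → length (meetTwice m z (suc r)) + m * size s) (sym order≡b)) (sym (size-extend m s))) Count.dense

  tower : ∀ n → suc (T * Lq) ≤ n →
    Σ (Tower (suc (suc (suc r₀)))) λ s → order s ≡ n × suc Q * binom (n ∸ 1) (suc r) ≤ Q * size s
  tower (suc x) (s≤s TL≤x) = extended x (x / Lq) bL≤x x<[b+1]L T≤b
    where
    bL≤x = proj₁ (quotient-bounds x Lq)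
    x<[b+1]L = proj₂ (quotient-bounds x Lq)
    T≤b : T ≤ x / Lq
    T≤b = s≤s⁻¹ (*-cancelʳ-< Lq T (suc (x / Lq)) (≤-<-trans TL≤x x<[b+1]L))

tower-dense : ∀ j → 2 ≤ j → Dense j
tower-dense (suc zero)            (s≤s ())
tower-dense (suc (suc zero))      _ = friendship-dense
tower-dense (suc (suc (suc r₀))) _ = extension-dense r₀ (tower-dense (suc (suc r₀)) (s≤s (s≤s z≤n)))

tower-tight-cycle-free : ∀ {j} (s : Tower (suc (suc (suc j)))) → TightCycleFree (towerGraph s)
tower-tight-cycle-free (extend m s) = extension-tight-cycle-free m s

theorem1p1 : (k : ℕ) → 3 ≤ k →
    Σ ℕ λ p → Σ ℕ λ q → 0 < p × 0 < q ×
    Σ ℕ λ N → (n : ℕ) → N ≤ n →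
    Σ (Hypergraph k n) λ H → TightCycleFree H ×
      (q + p) * ((n ∸ 1) C (k ∸ 1)) ≤ q * numEdges H
theorem1p1 (suc zero)       (s≤s ())
theorem1p1 (suc (suc zero)) (s≤s (s≤s ()))
theorem1p1 k@(suc (suc (suc _))) _ with tower-dense k (s≤s (s≤s z≤n))
... | Q , 0<Q , N , dense = 1 , Q , s≤s z≤n , 0<Q , N , λ n N≤n → witness n (dense n N≤n)
  where
  witness : ∀ n → Σ (Tower k) (λ s → order s ≡ n × suc Q * binom (n ∸ 1) (k ∸ 1) ≤ Q * size s) →
    Σ (Hypergraph k n) λ H → TightCycleFree H × (Q + 1) * ((n ∸ 1) C (k ∸ 1)) ≤ Q * numEdges H
  witness _ (s , refl , many) =
    towerGraph s , tower-tight-cycle-free s , subst₂ (λ u w → u * w ≤ Q * size s) (+-comm 1 Q) (binom≡C (order s ∸ 1) (k ∸ 1)) many
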